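{- Let $n$ be odd and let $\sigma$ be any circular permutation of $[n]$. Let $A \subseteq [n]$ be a subset of odd size $k$, and let $(a_0,\ldots,a_{k-1})$ be the ordering of $A$ (in clockwise order) with respect to $\sigma$. Then there exists an index $i \in \{0,\ldots,k-1\}$ such that $dist_{\sigma}(a_i,a_{i+\lfloor k/2\rfloor}) < \frac{n}{2}$ and $dist_{\sigma}(a_{i+\lfloor k/2\rfloor+1},a_i) < \frac{n}{2}$, where indices of $a$ are taken modulo $k$.
   Context: For a circular permutation $\sigma$ of $[n]$ and $a,b\in[n]$, $dist_{\sigma}(a,b)$ denotes the clockwise distance from $a$ to $b$ with respect to $\sigma$, i.e. one more than the number of elements lying between $a$ and $b$ in $\sigma$ going clockwise from $a$ to $b$. -}

module Defs where

open import Data.Nat using (ℕ; suc; _+_; _*_; _∸_; _<_; _/_; _%_)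
open import Data.Nat.DivMod using (_mod_)
open import Data.Fin using (Fin; toℕ)
open import Data.Fin.Permutation using (Permutation′; _⟨$⟩ʳ_)
open import Data.Fin.Subset using (Subset; _∈_)
open import Data.Product using (∃; _×_)
open import Relation.Binary.PropositionalEquality using (_≡_)

Odd : ℕ → Set
Odd n = ∃ λ m → n ≡ suc (2 * m)

-- A circular permutation of [n] is represented by a permutation σ of Fin n,
-- read as: element a sits at position σ ⟨$⟩ʳ a on the circle, and going
-- clockwise means increasing position (mod n).  Distances are invariant
-- under rotating the circle, so this representation loses nothing.
pos : ∀ {n} → Permutation′ n → Fin n → ℕ
pos σ a = toℕ (σ ⟨$⟩ʳ a)

-- clockwise distance from a to b: (pos b - pos a) mod n, which for a ≠ b is
-- one more than the number of elements strictly between a and b clockwise.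
dist : ∀ {n} → Permutation′ n → Fin n → Fin n → ℕ
dist {suc m} σ a b = (pos σ b + suc m ∸ pos σ a) % suc m

_⊕_ : ∀ {k} → Fin k → ℕ → Fin k
_⊕_ {suc m} i j = (toℕ i + j) mod (suc m)

-- a : Fin k → Fin n lists A in clockwise order w.r.t. σ: positions strictly
-- increase along a (starting point is some element of A), and the image is A.
IsClockwiseOrdering : ∀ {n k} → Permutation′ n → Subset n → (Fin k → Fin n) → Set
IsClockwiseOrdering {n} {k} σ A a =
  (∀ (i j : Fin k) → toℕ i < toℕ j → pos σ (a i) < pos σ (a j))
  × (∀ (i : Fin k) → a i ∈ A)
  × (∀ (x : Fin n) → x ∈ A → ∃ λ i → a i ≡ x)

module Submission where

-- Let c i be the position of a i on the circle, so c is
-- strictly increasing on the indices 0,…,k-1, k = 2m+1; extend indices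
-- cyclically (index y means y mod k).  Unrolling the circle, the lift
-- L y = c (y mod k) + n * (y / k) satisfies L (t + y) = L y + arc (y, t + y)
-- for t < k, so clockwise arcs spanning fewer than k steps add up and stay
-- below one full turn n.  Call y short when the half-chord, the arc from a_y
-- to a_{m+y}, is less than n/2.  The half-chords at s + y (s = m+1) and at
-- y are consecutive arcs of 2m steps in total, so at least one is short.
-- Walking along the odd cycle 0, s, 2s, …, ks ≡ 0 we therefore meet two
-- consecutive short indices y and s + y, and i = y is the required index:
-- the half-chord at s + y is exactly the arc from a_{i+m+1} back to a_i.

open import Defs
open import Data.Nat
  using (ℕ; suc; zero; _+_; _*_; _<_; _≤_; _∸_; _/_; _%_; _<?_; NonZero; z≤n; s≤s)
open import Data.Nat.Properties
open import Data.Nat.DivMod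
  using (_mod_; m≡m%n+[m/n]*n; [m+kn]%n≡m%n; [m+n]%n≡m%n; m<n⇒m%n≡m; m%n<n; m%n%n≡m%n;
         %-distribˡ-+; +-distrib-/; m<n⇒m/n≡0; m*n/n≡m; m*n%n≡0)
open import Data.Fin using (Fin; toℕ)
open import Data.Fin.Properties using (toℕ<n; toℕ-fromℕ<; fromℕ<-cong)
open import Data.Fin.Permutation using (Permutation′; _⟨$⟩ʳ_)
open import Data.Fin.Subset using (Subset; ∣_∣)
open import Data.Product using (∃; _×_; _,_)
open import Data.Sum using (_⊎_; inj₁; inj₂)
open import Data.Empty using (⊥-elim)
open import Function using (_∘_; id)
open import Function.Bundles using (_⇔_; mk⇔; Equivalence)
open import Relation.Nullary using (¬_; yes; no)
open import Relation.Unary using (Decidable)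
open import Relation.Binary.PropositionalEquality

-- If of any two consecutive naturals at least one
-- satisfies S, and S is periodic along the odd cycle 0,1,…,2m,2m+1 ≡ 0,
-- then S holds at two consecutive points: S cannot simply alternate.
module OddCycle (S : ℕ → Set) (S? : Decidable S)
                (cover : ∀ j → ¬ S j → S (suc j)) where

  Consecutive : Set
  Consecutive = ∃ λ j → S j × S (suc j)

  SameTruth : Set → Set → Set
  SameTruth P Q = (P → Q) × (¬ P → ¬ Q)

  two-steps : ∀ j → Consecutive ⊎ SameTruth (S j) (S (2 + j))
  two-steps j with S? j | S? (suc j) | S? (2 + j)
  ... | yes sj | yes sj+1 | _        = inj₁ (j , sj , sj+1)
  ... | yes sj | no ¬sj+1 | _        =
    inj₂ ((λ _ → cover (suc j) ¬sj+1) , (λ ¬sj → ⊥-elim (¬sj sj)))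
  ... | no ¬sj | _        | yes sj+2 = inj₁ (suc j , cover j ¬sj , sj+2)
  ... | no ¬sj | _        | no ¬sj+2 = inj₂ ((λ sj → ⊥-elim (¬sj sj)) , (λ _ → ¬sj+2))

  even-steps : ∀ i → Consecutive ⊎ SameTruth (S 0) (S (i * 2))
  even-steps zero = inj₂ (id , id)
  even-steps (suc i) with even-steps i | two-steps (i * 2)
  ... | inj₁ found       | _                = inj₁ found
  ... | inj₂ _           | inj₁ found       = inj₁ found
  ... | inj₂ (to , ¬to)  | inj₂ (to′ , ¬to′) = inj₂ (to′ ∘ to , ¬to′ ∘ ¬to)

  -- The odd step from 2m to 2m+1 ≡ 0 breaks the alternation.
  odd-cycle : ∀ m → S 0 ⇔ S (suc (2 * m)) → Consecutive
  odd-cycle m period with even-steps m | S? 0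
  ... | inj₁ found    | _      = found
  ... | inj₂ (to , _) | yes s0 =
    m * 2 , to s0 , subst (S ∘ suc) (*-comm 2 m) (Equivalence.to period s0)
  ... | inj₂ (_ , ¬to) | no ¬s0 =
    ⊥-elim (¬s0 (Equivalence.from period
      (subst (S ∘ suc) (*-comm m 2) (cover (m * 2) (¬to ¬s0)))))

%-block : ∀ r q k .{{_ : NonZero k}} → r < k → (r + q * k) % k ≡ r
%-block r q k r<k = trans ([m+kn]%n≡m%n r q k) (m<n⇒m%n≡m r<k)

/-block : ∀ r q k .{{_ : NonZero k}} → r < k → (r + q * k) / k ≡ q
/-block r q k r<k =
  trans (+-distrib-/ r (q * k) no-carry) (cong₂ _+_ (m<n⇒m/n≡0 r<k) (m*n/n≡m q k))
  where
  no-carry : r % k + (q * k) % k < k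
  no-carry = subst (_< k)
    (sym (trans (cong₂ _+_ (m<n⇒m%n≡m r<k) (m*n%n≡0 q k)) (+-identityʳ r))) r<k

%-shift : ∀ t {y y′} k .{{_ : NonZero k}} → y % k ≡ y′ % k → (t + y) % k ≡ (t + y′) % k
%-shift t {y} {y′} k e = begin
  (t + y) % k             ≡⟨ %-distribˡ-+ t y k ⟩
  (t % k + y % k) % k     ≡⟨ cong (λ r → (t % k + r) % k) e ⟩
  (t % k + y′ % k) % k    ≡⟨ %-distribˡ-+ t y′ k ⟨
  (t + y′) % k            ∎
  where open ≡-Reasoning

⊕-mod : ∀ {K} y t → (y mod suc K) ⊕ t ≡ (t + y) mod suc K
⊕-mod {K} y t = fromℕ<-cong _ _ same-remainder _ _
  where
  k : ℕ
  k = suc K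
  same-remainder : (toℕ (y mod k) + t) % k ≡ (t + y) % k
  same-remainder = begin
    (toℕ (y mod k) + t) % k ≡⟨ cong (λ r → (r + t) % k) (toℕ-fromℕ< (m%n<n y k)) ⟩
    (y % k + t) % k         ≡⟨ cong (_% k) (+-comm (y % k) t) ⟩
    (t + y % k) % k         ≡⟨ %-shift t k (m%n%n≡m%n y k) ⟩
    (t + y) % k             ∎
    where open ≡-Reasoning

less-than-half : ∀ a b {n} → a + b < n → n ≤ 2 * b → 2 * a < n
less-than-half a b {n} a+b<n n≤2b = +-cancelʳ-< n (2 * a) n (begin-strict
  2 * a + n        ≤⟨ +-monoʳ-≤ (2 * a) n≤2b ⟩
  2 * a + 2 * b    ≡⟨ *-distribˡ-+ 2 a b ⟨
  2 * (a + b)      <⟨ *-monoʳ-< 2 a+b<n ⟩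
  2 * n            ≡⟨ cong (n +_) (+-identityʳ n) ⟩
  n + n            ∎)
  where open ≤-Reasoning

-- Clockwise arc length from x to y on a circle of n = suc N positions;
-- dist σ a b is the arc from σ ⟨$⟩ʳ a to σ ⟨$⟩ʳ b.
arc : ∀ {N} → Fin (suc N) → Fin (suc N) → ℕ
arc {N} x y = (toℕ y + suc N ∸ toℕ x) % suc N

arc<n : ∀ {N} (x y : Fin (suc N)) → arc x y < suc N
arc<n {N} x y = m%n<n (toℕ y + suc N ∸ toℕ x) (suc N)

arc-forward : ∀ {N} (x y : Fin (suc N)) → toℕ x ≤ toℕ y → arc x y + toℕ x ≡ toℕ y
arc-forward {N} x y x≤y = trans (cong (_+ toℕ x) arc≡y∸x) (m∸n+n≡m x≤y)
  where
  n : ℕ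
  n = suc N
  arc≡y∸x : arc x y ≡ toℕ y ∸ toℕ x
  arc≡y∸x = begin
    (toℕ y + n ∸ toℕ x) % n   ≡⟨ cong (_% n) (+-∸-comm n x≤y) ⟩
    (toℕ y ∸ toℕ x + n) % n   ≡⟨ [m+n]%n≡m%n (toℕ y ∸ toℕ x) n ⟩
    (toℕ y ∸ toℕ x) % n       ≡⟨ m<n⇒m%n≡m y∸x<n ⟩
    toℕ y ∸ toℕ x             ∎
    where
    open ≡-Reasoning
    y∸x<n : toℕ y ∸ toℕ x < n
    y∸x<n = ≤-<-trans (m∸n≤m (toℕ y) (toℕ x)) (toℕ<n y)

arc-backward : ∀ {N} (x y : Fin (suc N)) → toℕ y < toℕ x →
  arc x y + toℕ x ≡ toℕ y + suc N
arc-backward {N} x y y<x = trans (cong (_+ toℕ x) (m<n⇒m%n≡m d<n)) d+x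
  where
  n d : ℕ
  n = suc N
  d = toℕ y + n ∸ toℕ x
  d+x : d + toℕ x ≡ toℕ y + n
  d+x = m∸n+n≡m (≤-trans (<⇒≤ (toℕ<n x)) (m≤n+m n (toℕ y)))
  d<n : d < n
  d<n = +-cancelʳ-< (toℕ x) d n
    (subst (_< n + toℕ x) (sym d+x) (subst (toℕ y + n <_) (+-comm (toℕ x) n) (+-monoˡ-< n y<x)))

module Unrolling {N K : ℕ} (c : Fin (suc K) → Fin (suc N))
                 (increasing : ∀ i j → toℕ i < toℕ j → toℕ (c i) < toℕ (c j)) where

  n k : ℕ
  n = suc N
  k = suc K

  cyc : ℕ → Fin n
  cyc y = c (y mod k)

  p : ℕ → ℕ
  p y = toℕ (cyc y)

  cyc-mod : ∀ y y′ → y % k ≡ y′ % k → cyc y ≡ cyc y′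
  cyc-mod _ _ e = cong c (fromℕ<-cong _ _ e _ _)

  p-increasing : ∀ {r r′} → r < r′ → r′ < k → p r < p r′
  p-increasing {r} {r′} r<r′ r′<k = increasing (r mod k) (r′ mod k)
    (subst₂ _<_ (sym (index r (<-trans r<r′ r′<k))) (sym (index r′ r′<k)) r<r′)
    where
    index : ∀ x → x < k → toℕ (x mod k) ≡ x
    index x x<k = trans (toℕ-fromℕ< (m%n<n x k)) (m<n⇒m%n≡m x<k)

  p-monotone : ∀ {r r′} → r ≤ r′ → r′ < k → p r ≤ p r′
  p-monotone r≤r′ r′<k with m≤n⇒m<n∨m≡n r≤r′
  ... | inj₁ r<r′ = <⇒≤ (p-increasing r<r′ r′<k)
  ... | inj₂ refl = ≤-refl

  lift : ℕ → ℕ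
  lift y = p y + n * (y / k)

  cyc-block : ∀ {r} q → r < k → cyc (r + q * k) ≡ cyc r
  cyc-block {r} q r<k =
    cyc-mod (r + q * k) r (trans (%-block r q k r<k) (sym (m<n⇒m%n≡m r<k)))

  lift-block : ∀ {r} q → r < k → lift (r + q * k) ≡ p r + n * q
  lift-block {r} q r<k =
    cong₂ (λ x d → toℕ x + n * d) (cyc-block q r<k) (/-block r q k r<k)

  -- Write y = r + q * k; the step r → t + r either stays in the current
  -- round (t + r < k) or passes the origin once (t + r = u + k).
  ArcLifts : ℕ → ℕ → Set
  ArcLifts t y = arc (cyc y) (cyc (t + y)) + lift y ≡ lift (t + y)

  lift-arc-same-round : ∀ t r q → r < k → t + r < k → ArcLifts t (r + q * k)
  lift-arc-same-round t r q r<k t+r<k = begin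
    arc (cyc (r + q * k)) (cyc (t + (r + q * k))) + lift (r + q * k)
      ≡⟨ cong₂ (λ x y → arc x y + lift (r + q * k)) (cyc-block q r<k) end-point ⟩
    arc (cyc r) (cyc (t + r)) + lift (r + q * k)
      ≡⟨ cong (arc (cyc r) (cyc (t + r)) +_) (lift-block q r<k) ⟩
    arc (cyc r) (cyc (t + r)) + (p r + n * q)
      ≡⟨ +-assoc (arc (cyc r) (cyc (t + r))) (p r) (n * q) ⟨
    arc (cyc r) (cyc (t + r)) + p r + n * q
      ≡⟨ cong (_+ n * q) (arc-forward (cyc r) (cyc (t + r)) (p-monotone (m≤n+m r t) t+r<k)) ⟩
    p (t + r) + n * q
      ≡⟨ lift-block q t+r<k ⟨
    lift (t + r + q * k)
      ≡⟨ cong lift same-round ⟨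
    lift (t + (r + q * k)) ∎
    where
    open ≡-Reasoning
    same-round : t + (r + q * k) ≡ t + r + q * k
    same-round = sym (+-assoc t r (q * k))
    end-point : cyc (t + (r + q * k)) ≡ cyc (t + r)
    end-point = trans (cong cyc same-round) (cyc-block q t+r<k)

  lift-arc-next-round : ∀ t r q → t < k → r < k → k ≤ t + r → ArcLifts t (r + q * k)
  lift-arc-next-round t r q t<k r<k k≤t+r = begin
    arc (cyc (r + q * k)) (cyc (t + (r + q * k))) + lift (r + q * k)
      ≡⟨ cong₂ (λ x y → arc x y + lift (r + q * k)) (cyc-block q r<k) end-point ⟩
    arc (cyc r) (cyc u) + lift (r + q * k)
      ≡⟨ cong (arc (cyc r) (cyc u) +_) (lift-block q r<k) ⟩
    arc (cyc r) (cyc u) + (p r + n * q)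
      ≡⟨ +-assoc (arc (cyc r) (cyc u)) (p r) (n * q) ⟨
    arc (cyc r) (cyc u) + p r + n * q
      ≡⟨ cong (_+ n * q) (arc-backward (cyc r) (cyc u) (p-increasing u<r r<k)) ⟩
    p u + n + n * q
      ≡⟨ +-assoc (p u) n (n * q) ⟩
    p u + (n + n * q)
      ≡⟨ cong (p u +_) (*-suc n q) ⟨
    p u + n * suc q
      ≡⟨ lift-block (suc q) u<k ⟨
    lift (u + suc q * k)
      ≡⟨ cong lift next-round ⟨
    lift (t + (r + q * k)) ∎
    where
    open ≡-Reasoning
    u : ℕ
    u = t + r ∸ k
    u+k : u + k ≡ t + r
    u+k = m∸n+n≡m k≤t+r
    u<r : u < r
    u<r = +-cancelʳ-< k u r
      (subst (_< r + k) (sym u+k) (subst (t + r <_) (+-comm k r) (+-monoˡ-< r t<k)))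
    u<k : u < k
    u<k = <-trans u<r r<k
    next-round : t + (r + q * k) ≡ u + suc q * k
    next-round = begin
      t + (r + q * k)   ≡⟨ +-assoc t r (q * k) ⟨
      t + r + q * k     ≡⟨ cong (_+ q * k) u+k ⟨
      u + k + q * k     ≡⟨ +-assoc u k (q * k) ⟩
      u + suc q * k     ∎
    end-point : cyc (t + (r + q * k)) ≡ cyc u
    end-point = trans (cong cyc next-round) (cyc-block (suc q) u<k)

  lift-arc : ∀ t y → t < k → ArcLifts t y
  lift-arc t y t<k =
    subst (ArcLifts t) (sym (m≡m%n+[m/n]*n y k)) (in-block (y % k) (y / k) (m%n<n y k))
    where
    in-block : ∀ r q → r < k → ArcLifts t (r + q * k)
    in-block r q r<k with t + r <? k
    ... | yes t+r<k = lift-arc-same-round t r q r<k t+r<k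
    ... | no t+r≮k  = lift-arc-next-round t r q t<k r<k (≮⇒≥ t+r≮k)

  arc-additive : ∀ u t y → u + t < k →
    arc (cyc y) (cyc (t + y)) + arc (cyc (t + y)) (cyc (u + (t + y)))
      ≡ arc (cyc y) (cyc (u + t + y))
  arc-additive u t y u+t<k = +-cancelʳ-≡ (lift y) _ _ (begin
    arc₁ + arc₂ + lift y     ≡⟨ cong (_+ lift y) (+-comm arc₁ arc₂) ⟩
    arc₂ + arc₁ + lift y     ≡⟨ +-assoc arc₂ arc₁ (lift y) ⟩
    arc₂ + (arc₁ + lift y)   ≡⟨ cong (arc₂ +_) (lift-arc t y t<k) ⟩
    arc₂ + lift (t + y)      ≡⟨ lift-arc u (t + y) u<k ⟩
    lift (u + (t + y))       ≡⟨ cong lift (+-assoc u t y) ⟨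
    lift (u + t + y)         ≡⟨ lift-arc (u + t) y u+t<k ⟨
    arc (cyc y) (cyc (u + t + y)) + lift y ∎)
    where
    open ≡-Reasoning
    t<k : t < k
    t<k = ≤-<-trans (m≤n+m t u) u+t<k
    u<k : u < k
    u<k = ≤-<-trans (m≤m+n u t) u+t<k
    arc₁ arc₂ : ℕ
    arc₁ = arc (cyc y) (cyc (t + y))
    arc₂ = arc (cyc (t + y)) (cyc (u + (t + y)))

module HalfChords (N m : ℕ) (c : Fin (suc (2 * m)) → Fin (suc N))
                  (increasing : ∀ i j → toℕ i < toℕ j → toℕ (c i) < toℕ (c j)) where

  open Unrolling c increasing

  s : ℕ
  s = suc m

  s+m≡k : s + m ≡ k
  s+m≡k = cong (λ h → suc (m + h)) (sym (+-identityʳ m))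

  chord : ℕ → ℕ
  chord y = arc (cyc y) (cyc (m + y))

  chord-mod : ∀ y y′ → y % k ≡ y′ % k → chord y ≡ chord y′
  chord-mod y y′ e = cong₂ arc (cyc-mod y y′ e) (cyc-mod (m + y) (m + y′) (%-shift m k e))

  opposite : ∀ y → (m + (s + y)) % k ≡ y % k
  opposite y = begin
    (m + (s + y)) % k   ≡⟨ cong (_% k) (+-assoc m s y) ⟨
    (m + s + y) % k     ≡⟨ cong (λ h → (h + y) % k) (trans (+-comm m s) s+m≡k) ⟩
    (k + y) % k         ≡⟨ cong (_% k) (+-comm k y) ⟩
    (y + k) % k         ≡⟨ [m+n]%n≡m%n y k ⟩
    y % k               ∎
    where open ≡-Reasoning

  chord-back : ∀ y → chord (s + y) ≡ arc (cyc (s + y)) (cyc y)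
  chord-back y = cong (arc (cyc (s + y))) (cyc-mod (m + (s + y)) y (opposite y))

  -- Two successive half-chords make up 2m < k steps, hence less than a turn.
  chord-pair : ∀ y → chord y + chord (m + y) < n
  chord-pair y = subst (_< n) (sym (arc-additive m m y (s≤s m+m≤2m)))
                       (arc<n (cyc y) (cyc (m + m + y)))
    where
    m+m≤2m : m + m ≤ 2 * m
    m+m≤2m = ≤-reflexive (cong (m +_) (sym (+-identityʳ m)))

  short : ℕ → Set
  short y = 2 * chord y < n

  short-mod : ∀ y y′ → y % k ≡ y′ % k → short y → short y′
  short-mod y y′ e = subst (λ d → 2 * d < n) (chord-mod y y′ e)

  -- The half-chords at y and s + y together span less than a turn, so one
  -- of them is short.
  short-complement : ∀ y → ¬ short y → short (s + y)
  short-complement y not-short =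
    less-than-half (chord (s + y)) (chord y) chords<n (≮⇒≥ not-short)
    where
    chords<n : chord (s + y) + chord y < n
    chords<n = subst (λ d → chord (s + y) + d < n)
                     (chord-mod (m + (s + y)) y (opposite y)) (chord-pair (s + y))

  -- Along 0, s, 2s, … the short indices cover every other step, and
  -- k * s ≡ 0, so the odd-cycle principle yields two consecutive ones.
  short-pair : ∃ λ y → short y × short (s + y)
  short-pair with OddCycle.odd-cycle (λ j → short (j * s)) (λ j → 2 * chord (j * s) <? n)
                    (λ j → short-complement (j * s)) m
                    (mk⇔ (short-mod 0 (k * s) (sym ks≡0)) (short-mod (k * s) 0 ks≡0))
    where
    ks≡0 : (k * s) % k ≡ 0
    ks≡0 = trans (cong (_% k) (*-comm k s)) (m*n%n≡0 s k)
  ... | j , short-j , short-j+1 = j * s , short-j , short-j+1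

  halving : ∃ λ (i : Fin k) →
    (2 * arc (c i) (c (i ⊕ m)) < n) × (2 * arc (c (i ⊕ suc m)) (c i) < n)
  halving with short-pair
  ... | y , short-y , short-s+y = y mod k , first , second
    where
    first : 2 * arc (cyc y) (c ((y mod k) ⊕ m)) < n
    first = subst (λ i → 2 * arc (cyc y) (c i) < n) (sym (⊕-mod y m)) short-y
    second : 2 * arc (c ((y mod k) ⊕ s)) (cyc y) < n
    second = subst (λ i → 2 * arc (c i) (cyc y) < n) (sym (⊕-mod y s))
                   (subst (λ d → 2 * d < n) (chord-back y) short-s+y)

half : ∀ m → suc (2 * m) / 2 ≡ m
half m = trans (cong (λ h → suc h / 2) (*-comm 2 m)) (/-block 1 m 2 (s≤s (s≤s z≤n)))

corollary2 : (n : ℕ) → Odd n → (σ : Permutation′ n) → (A : Subset n) →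
    (k : ℕ) → ∣ A ∣ ≡ k → Odd k → (a : Fin k → Fin n) →
    IsClockwiseOrdering σ A a →
    ∃ λ (i : Fin k) →
      (2 * dist σ (a i) (a (i ⊕ (k / 2))) < n)
      × (2 * dist σ (a (i ⊕ suc (k / 2))) (a i) < n)
corollary2 .(suc (2 * N)) (N , refl) σ A .(suc (2 * m)) _ (m , refl) a (increasing , _)
  rewrite half m = HalfChords.halving (2 * N) m (λ i → σ ⟨$⟩ʳ a i) increasing
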